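{- Let $\mu=[1^{\mu_1},2^{\mu_2},\dots]$ with $\mu_1\le1$ and $k=\sum_i\mu_i(i-2)+4$. Let $(T,L)$ be a nice decorated plane tree of profile $(\mu,k-2)$. Then there exists a sequence of at most $k$ glue and cut operations connecting $(T,L)$ to a nice decorated plane tree $(T',L')$ of the same profile such that $T'$ is a caterpillar.
   Context: A decorated plane tree is $(T,L)$ with $T$ a tree embedded in the sphere and $L$ a subset of its leaves ($L$-leaves; other leaves are $\overline L$-leaves). It has profile $(\mu,\ell)$ if $|L|=\ell$ and $\mu_i$ is the number of vertices of $T$ not in $L$ of degree $i$. It is nice if $\mu_1=0$, or $\mu_1=1$ and the unique $\overline L$-leaf is adjacent to a vertex of maximal degree. A caterpillar is a tree whose internal (non-leaf) vertices form a path. Glue and cut: remove two $L$-leaves and replace them by an edge between their parents (drawn in the complement of $T$, at the positions of the removed leaf edges), creating a unique cycle; then remove an edge $uv$ of this cycle and attach two new $L$-leaves, one at $u$ and one at $v$, at the positions previously occupied by $uv$. -}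

module Defs where

open import Data.Nat using (ℕ; zero; suc; _+_; _*_; _≤_; _≡ᵇ_)
open import Data.Nat.Properties using ()
open import Data.Integer as ℤ using (ℤ; +_)
open import Data.Fin using (Fin; _≟_)
open import Data.Bool using (Bool; true; false; not; _∧_; if_then_else_)
open import Data.List using (List; length; filterᵇ; allFin; applyUpTo; map; sum; foldr)
open import Data.List.Membership.Propositional using (_∈_)
open import Data.List.Relation.Unary.Unique.Propositional using (Unique)
open import Data.List.Relation.Unary.Linked using (Linked)
open import Data.Product using (Σ; ∃; ∃-syntax; _×_; _,_)
open import Data.Sum using (_⊎_)
open import Function using (_∘_; _⇔_)
open import Relation.Nullary using (¬_; does)
open import Relation.Binary.PropositionalEquality using (_≡_; _≢_)

iter : ∀ {A : Set} → (A → A) → ℕ → A → A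
iter f zero x = x
iter f (suc k) x = f (iter f k x)

-- walks in the graph given by darts: vert d is the vertex of dart d,
-- opp d the other half of the edge of d
data Walk {nV nD : ℕ} (vert : Fin nD → Fin nV) (opp : Fin nD → Fin nD)
     : Fin nV → Fin nV → Set where
  here : ∀ {v} → Walk vert opp v v
  step : ∀ {w} (d : Fin nD) → Walk vert opp (vert (opp d)) w → Walk vert opp (vert d) w

-- A plane tree (combinatorial map of a tree on the sphere) with vertex
-- set Fin nV and dart (half-edge) set Fin nD.
record PlaneTree (nV nD : ℕ) : Set where
  field
    vert      : Fin nD → Fin nV
    opp       : Fin nD → Fin nD
    rot       : Fin nD → Fin nD          -- next dart counterclockwise around vert
    rot⁻¹     : Fin nD → Fin nD
    opp-invol : ∀ d → opp (opp d) ≡ d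
    opp-nofix : ∀ d → opp d ≢ d
    rot-inv₁  : ∀ d → rot (rot⁻¹ d) ≡ d
    rot-inv₂  : ∀ d → rot⁻¹ (rot d) ≡ d
    rot-vert  : ∀ d → vert (rot d) ≡ vert d
    rot-cyc   : ∀ d d' → vert d ≡ vert d' → ∃[ k ] iter rot k d ≡ d'
    vert-surj : ∀ v → ∃[ d ] vert d ≡ v
    connected : ∀ u v → Walk vert opp u v
    edges     : nD + 2 ≡ 2 * nV          -- #edges = #vertices - 1

  deg : Fin nV → ℕ
  deg v = length (filterᵇ (λ d → does (vert d ≟ v)) (allFin nD))

  Adjacent : Fin nV → Fin nV → Set
  Adjacent u v = ∃[ d ] (vert d ≡ u × vert (opp d) ≡ v)

record DTree (nV nD : ℕ) : Set where
  field
    tree   : PlaneTree nV nD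
    L      : Fin nV → Bool
  open PlaneTree tree public
  field
    L-leaf : ∀ v → L v ≡ true → deg v ≡ 1

  ℓ : ℕ
  ℓ = length (filterᵇ L (allFin nV))

  μ : ℕ → ℕ
  μ i = length (filterᵇ (λ v → not (L v) ∧ (deg v ≡ᵇ i)) (allFin nV))

  -- k = Σ_{i ≥ 1} μ_i (i - 2) + 4   (degrees are at most nD)
  k : ℤ
  k = sum' (map (λ i → (+ μ i) ℤ.* ((+ i) ℤ.- (+ 2))) (applyUpTo suc nD)) ℤ.+ (+ 4)
    where
    sum' : List ℤ → ℤ
    sum' = foldr ℤ._+_ (+ 0)

  Nice : Set
  Nice = μ 1 ≡ 0
       ⊎ (μ 1 ≡ 1 × (∀ v → L v ≡ false → deg v ≡ 1 →
            ∃[ w ] (Adjacent v w × (∀ u → deg u ≤ deg w))))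

  Internal : Fin nV → Set
  Internal v = 2 ≤ deg v

  Caterpillar : Set
  Caterpillar = ∃[ ps ] (Unique ps × (∀ v → Internal v ⇔ v ∈ ps) × Linked Adjacent ps)

-- opposite map after glue and cut: leaf darts xa, xb (at L-leaves a, b),
-- ya = opp xa and yb = opp xb are glued into a new edge; then the edge
-- {z , z'} of the glued graph is cut, the leaf darts xa and xb being
-- reused for the two new L-leaves attached at vert z and vert z'.
gcOpp : ∀ {nD} → (Fin nD → Fin nD) → (xa xb z : Fin nD) → Fin nD → Fin nD
gcOpp {nD} opp xa xb z d =
  if does (d ≟ xa) then z else
  if does (d ≟ xb) then z' else
  if does (d ≟ z) then xa else
  if does (d ≟ z') then xb else
  oppG d
  where
  ya = opp xa
  yb = opp xb
  oppG : Fin nD → Fin nD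
  oppG e = if does (e ≟ ya) then yb else if does (e ≟ yb) then ya else opp e
  z' = oppG z

-- Vertex and dart labels are
-- kept: the new L-leaves reuse the labels of the removed ones.  That T'
-- is again a tree (connected) expresses that the cut edge lies on the
-- unique cycle of the glued graph.
GlueCut : ∀ {nV nD} → DTree nV nD → DTree nV nD → Set
GlueCut {nV} {nD} T T' =
  Σ (Fin nD) λ xa → Σ (Fin nD) λ xb → Σ (Fin nD) λ z →
    xa ≢ xb × T.L (T.vert xa) ≡ true × T.L (T.vert xb) ≡ true
    × T.opp xa ≢ xb
    × z ≢ xa × z ≢ xb
    × (∀ d → T'.vert d ≡ T.vert d)
    × (∀ d → T'.rot d ≡ T.rot d)
    × (∀ v → T'.L v ≡ T.L v)
    × (∀ d → T'.opp d ≡ gcOpp T.opp xa xb z d)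
  where
  module T = DTree T
  module T' = DTree T'

data GCPath {nV nD : ℕ} : ℕ → DTree nV nD → DTree nV nD → Set where
  done : ∀ {T} → GCPath 0 T T
  step : ∀ {n T T₁ T₂} → GlueCut T T₁ → GCPath n T₁ T₂ → GCPath (suc n) T T₂

{-# OPTIONS --safe #-}
module Submission where

-- A glue-and-cut keeps vertices, darts, rotations and L and only re-pairs darts, so
-- degrees, μ and ℓ never change and every tree met is T with another opposite map.
-- Keep a spine: a path of internal vertices whose head h has all its internal
-- neighbours on the spine and whose other end has at most one internal neighbour.
-- If an internal vertex x off the spine hangs at a spine vertex y, then y is interior
-- to the spine, so deg y ≥ 3; grow a maximal path from x away from the spine, to c.
-- By niceness h and c carry L-leaves a and b; glue a with b and cut yx.  Now c hangs
-- at h, so the spine grows past h, and its new head has a leaf that was not adjacent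
-- to the old spine.  The leaves not adjacent to the spine, at most ℓ + μ₁ ≤ k - 1 of
-- them, therefore decrease at every step, and once nothing hangs off the spine it
-- contains every internal vertex: the tree is a caterpillar.

open import Defs
open import Data.Nat using (ℕ; _≤_)
open import Data.Integer as ℤ using (+_)
open import Data.Product using (∃-syntax; _×_)
open import Relation.Binary.PropositionalEquality using (_≡_)

import Data.Nat as ℕ
open import Data.Nat using (zero; suc; _+_; _*_; _<_; z≤n; s≤s; _≤?_; _≡ᵇ_)
open import Data.Nat.Properties
  using ( ≤-refl; ≤-reflexive; ≤-trans; ≤-antisym; ≤-pred; <-irrefl; <-≤-trans; ≰⇒>; n≮0; n≤1+n; m≤n⇒m≤1+n
        ; m≤n+m; m≤m+n; +-suc; +-identityʳ; +-mono-≤; +-monoˡ-≤; +-monoʳ-≤; +-cancelʳ-≡; *-suc )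
import Data.Integer.Properties as ℤP
open import Data.Fin using (Fin; zero; suc)
open import Data.Fin.Properties using (_≟_; any?)
import Data.Bool as Bool
open import Data.Bool using (Bool; true; false; not; _∧_; if_then_else_)
open import Data.List using (List; []; _∷_; length; filterᵇ; tabulate; allFin)
open import Data.List.Properties using (∷-injectiveˡ)
open import Data.List.Membership.Propositional using (_∈_; _∉_)
open import Data.List.Relation.Unary.Any using (here; there)
open import Data.List.Relation.Unary.All using (All; []; _∷_) renaming (lookup to All-lookup)
open import Data.List.Relation.Unary.All.Properties using (¬Any⇒All¬)
open import Data.List.Relation.Unary.Linked as Linked using (Linked; []; [-]; _∷_)
open import Data.List.Relation.Unary.Unique.Propositional using (Unique)
open import Data.List.Relation.Unary.Unique.Propositional.Properties using (Unique[x∷xs]⇒x∉xs)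
open import Data.List.Relation.Unary.AllPairs as AllPairs using ([]; _∷_)
open import Data.Product using (Σ; ∃; _,_; proj₁; proj₂)
open import Data.Sum using (_⊎_; inj₁; inj₂; [_,_])
open import Data.Unit using (⊤; tt)
open import Data.Empty using (⊥; ⊥-elim)
open import Function using (_∘_; id; const)
open import Function.Bundles using (mk⇔)
open import Relation.Nullary using (¬_; Dec; yes; no; does; ¬?; _×-dec_)
open import Relation.Nullary.Decidable using (dec-true; dec-false)
open import Relation.Binary.PropositionalEquality using (_≢_; refl; sym; trans; cong; subst; subst₂; module ≡-Reasoning)

dec-true⁻¹ : ∀ {A : Set} (a? : Dec A) → does a? ≡ true → A
dec-true⁻¹ (yes a) _ = a

true≢false : true ≢ false
true≢false ()

module _ {A : Set} {n : ℕ} {x y : Fin n} {a b : A} where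

  if-≟-yes : x ≡ y → (if does (x ≟ y) then a else b) ≡ a
  if-≟-yes x≡y rewrite dec-true (x ≟ y) x≡y = refl

  if-≟-no : x ≢ y → (if does (x ≟ y) then a else b) ≡ b
  if-≟-no x≢y rewrite dec-false (x ≟ y) x≢y = refl

module _ {a p} {A : Set a} (P : A → Set p) (μ : A → ℕ) {n : ℕ} (μ≤n : ∀ x → μ x ≤ n) where

  bounded-rec : (∀ x → (∀ y → μ x < μ y → P y) → P x) → ∀ x → P x
  bounded-rec rec x = go n x (m≤n+m n (μ x))
    where
    go : ∀ fuel x → n ≤ μ x + fuel → P x
    go zero       x n≤ = rec x λ y μx<μy →
      ⊥-elim (<-irrefl refl (≤-trans μx<μy (≤-trans (μ≤n y) (subst (n ≤_) (+-identityʳ (μ x)) n≤))))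
    go (suc fuel) x n≤ = rec x λ y μx<μy →
      go fuel y (≤-trans n≤ (≤-trans (≤-reflexive (+-suc (μ x) fuel)) (+-monoˡ-≤ fuel μx<μy)))

≤-if : ∀ {c} (b : Bool) → c ≤ (if b then suc c else c)
≤-if true  = n≤1+n _
≤-if false = ≤-refl

count : ∀ {n} → (Fin n → Bool) → ℕ
count {zero}  p = 0
count {suc n} p = if p zero then suc (count (p ∘ suc)) else count (p ∘ suc)

_⊆ᵇ_ : ∀ {n} → (Fin n → Bool) → (Fin n → Bool) → Set
p ⊆ᵇ q = ∀ x → p x ≡ true → q x ≡ true

insert : ∀ {n} → (Fin n → Bool) → Fin n → Fin n → Bool
insert p x y = if does (y ≟ x) then true else p y

delete : ∀ {n} → (Fin n → Bool) → Fin n → Fin n → Bool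
delete p x y = if does (y ≟ x) then false else p y

⁅_⁆ : ∀ {n} → Fin n → Fin n → Bool
⁅ x ⁆ = insert (const false) x

module _ {n : ℕ} where

  length-filterᵇ-tabulate : ∀ {m} (p : Fin n → Bool) (f : Fin m → Fin n) →
    length (filterᵇ p (tabulate f)) ≡ count (p ∘ f)
  length-filterᵇ-tabulate {zero}  p f = refl
  length-filterᵇ-tabulate {suc m} p f with p (f zero)
  ... | true  = cong suc (length-filterᵇ-tabulate p (f ∘ suc))
  ... | false = length-filterᵇ-tabulate p (f ∘ suc)

  length-filterᵇ-allFin : (p : Fin n → Bool) → length (filterᵇ p (allFin n)) ≡ count p
  length-filterᵇ-allFin p = length-filterᵇ-tabulate p id

  insert-x : (p : Fin n → Bool) (x : Fin n) → insert p x x ≡ true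
  insert-x p x = if-≟-yes {x = x} {y = x} refl

  insert-y : (p : Fin n → Bool) {x y : Fin n} → y ≢ x → insert p x y ≡ p y
  insert-y p {x} {y} y≢x = if-≟-no {x = y} {y = x} y≢x

  ⊆ᵇ-insert : (p : Fin n → Bool) (x : Fin n) → p ⊆ᵇ insert p x
  ⊆ᵇ-insert p x y py with y ≟ x
  ... | yes _ = refl
  ... | no  _ = py

  insert≡true : (p : Fin n → Bool) {x y : Fin n} → insert p x y ≡ true → y ≡ x ⊎ p y ≡ true
  insert≡true p {x} {y} e with y ≟ x
  ... | yes y≡x = inj₁ y≡x
  ... | no  _   = inj₂ e

  delete≡true : (p : Fin n → Bool) {x y : Fin n} → delete p x y ≡ true → y ≢ x × p y ≡ true
  delete≡true p {x} {y} e with y ≟ x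
  ... | no y≢x = y≢x , e

count≤n : ∀ {n} (p : Fin n → Bool) → count p ≤ n
count≤n {zero}  p = z≤n
count≤n {suc n} p with p zero
... | true  = s≤s (count≤n (p ∘ suc))
... | false = m≤n⇒m≤1+n (count≤n (p ∘ suc))

count-mono : ∀ {n} {p q : Fin n → Bool} → p ⊆ᵇ q → count p ≤ count q
count-mono {zero}          p⊆q = z≤n
count-mono {suc n} {p} {q} p⊆q with p zero in p0 | q zero in q0
... | true  | true  = s≤s (count-mono (p⊆q ∘ suc))
... | false | true  = m≤n⇒m≤1+n (count-mono (p⊆q ∘ suc))
... | false | false = count-mono (p⊆q ∘ suc)
... | true  | false = ⊥-elim (true≢false (trans (sym (p⊆q zero p0)) q0))

count-mono-< : ∀ {n} {p q : Fin n → Bool} → p ⊆ᵇ q →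
  ∀ x → p x ≡ false → q x ≡ true → count p < count q
count-mono-< {suc n} {p} {q} p⊆q zero px qx rewrite px | qx = s≤s (count-mono (p⊆q ∘ suc))
count-mono-< {suc n} {p} {q} p⊆q (suc x) px qx with p zero in p0 | q zero in q0
... | true  | true  = s≤s (count-mono-< (p⊆q ∘ suc) x px qx)
... | false | true  = m≤n⇒m≤1+n (count-mono-< (p⊆q ∘ suc) x px qx)
... | false | false = count-mono-< (p⊆q ∘ suc) x px qx
... | true  | false = ⊥-elim (true≢false (trans (sym (p⊆q zero p0)) q0))

count-∪ : ∀ {n} {p q r : Fin n → Bool} → (∀ x → p x ≡ true → q x ≡ true ⊎ r x ≡ true) →
  count p ≤ count q + count r
count-∪ {zero} _ = z≤n
count-∪ {suc n} {p} {q} {r} h with p zero in p0 | q zero in q0 | r zero in r0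
... | false | b | c     = ≤-trans (count-∪ (h ∘ suc)) (+-mono-≤ (≤-if b) (≤-if c))
... | true  | true  | c = s≤s (≤-trans (count-∪ (h ∘ suc)) (+-monoʳ-≤ _ (≤-if c)))
... | true  | false | true = ≤-trans (s≤s (count-∪ (h ∘ suc))) (≤-reflexive (sym (+-suc _ _)))
... | true  | false | false with h zero p0
...   | inj₁ q0′ = ⊥-elim (true≢false (trans (sym q0′) q0))
...   | inj₂ r0′ = ⊥-elim (true≢false (trans (sym r0′) r0))

count-all-true : ∀ {n} {p : Fin n → Bool} → (∀ x → p x ≡ true) → count p ≡ n
count-all-true {zero}      _ = refl
count-all-true {suc n} {p} h rewrite h zero = cong suc (count-all-true (h ∘ suc))

count-∅ : ∀ {n} → count {n} (const false) ≡ 0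
count-∅ {zero}  = refl
count-∅ {suc n} = count-∅ {n}

count-pos : ∀ {n} {p : Fin n → Bool} x → p x ≡ true → 1 ≤ count p
count-pos {n} {p} x px = subst (_< count p) (count-∅ {n}) (count-mono-< {p = const false} (λ _ ()) x refl px)

count≡0⇒false : ∀ {n} {p : Fin n → Bool} → count p ≡ 0 → ∀ x → p x ≡ false
count≡0⇒false {p = p} c≡0 x with p x in px
... | false = refl
... | true  = ⊥-elim (<-irrefl refl (subst (1 ≤_) c≡0 (count-pos x px)))

count-pos⇒∃ : ∀ {n} {p : Fin n → Bool} → 1 ≤ count p → ∃[ x ] p x ≡ true
count-pos⇒∃ {suc n} {p} h with p zero in p0
... | true  = zero , p0
... | false with x , px ← count-pos⇒∃ {p = p ∘ suc} h = suc x , px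

count-insert : ∀ {n} (p : Fin n → Bool) x → p x ≡ false → count (insert p x) ≡ suc (count p)
count-insert p zero px rewrite px = refl
count-insert p (suc x) px with p zero
... | true  = cong suc (count-insert (p ∘ suc) x px)
... | false = count-insert (p ∘ suc) x px

count-⁅⁆ : ∀ {n} (x : Fin n) → count ⁅ x ⁆ ≡ 1
count-⁅⁆ {n} x = trans (count-insert (const false) x refl) (cong suc (count-∅ {n}))

count≤suc-delete : ∀ {n} (p : Fin n → Bool) x → count p ≤ suc (count (delete p x))
count≤suc-delete p zero with p zero
... | true  = ≤-refl
... | false = n≤1+n _
count≤suc-delete p (suc x) with p zero
... | true  = s≤s (count≤suc-delete (p ∘ suc) x)
... | false = count≤suc-delete (p ∘ suc) x

insert-⊆ᵇ : ∀ {n} {p q : Fin n → Bool} {x} → p ⊆ᵇ q → q x ≡ true → insert p x ⊆ᵇ q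
insert-⊆ᵇ {p = p} {x = x} p⊆q qx y e with insert≡true p e
... | inj₁ refl = qx
... | inj₂ py   = p⊆q y py

∃-other : ∀ {n} {p : Fin n → Bool} x → 2 ≤ count p → ∃[ y ] (y ≢ x × p y ≡ true)
∃-other {p = p} x h =
  let y , e = count-pos⇒∃ {p = delete p x} (≤-pred (≤-trans h (count≤suc-delete p x)))
  in y , delete≡true p e

∃-third : ∀ {n} {p : Fin n → Bool} x y → 3 ≤ count p → ∃[ w ] (w ≢ x × w ≢ y × p w ≡ true)
∃-third {p = p} x y h =
  let w , w≢y , e = ∃-other {p = delete p x} y (≤-pred (≤-trans h (count≤suc-delete p x)))
      w≢x , pw = delete≡true p e
  in w , w≢x , w≢y , pw

count≥2 : ∀ {n} {p : Fin n → Bool} {x y} → x ≢ y → p x ≡ true → p y ≡ true → 2 ≤ count p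
count≥2 {p = p} {x} {y} x≢y px py =
  subst (λ m → suc m ≤ count p) (count-⁅⁆ x)
    (count-mono-< (insert-⊆ᵇ (λ _ ()) px) y (insert-y (const false) (x≢y ∘ sym)) py)

count≥3 : ∀ {n} {p : Fin n → Bool} {x y w} → x ≢ y → x ≢ w → y ≢ w →
  p x ≡ true → p y ≡ true → p w ≡ true → 3 ≤ count p
count≥3 {p = p} {x} {y} {w} x≢y x≢w y≢w px py pw =
  subst (λ m → suc m ≤ count p) count-xy
    (count-mono-< (insert-⊆ᵇ (insert-⊆ᵇ (λ _ ()) px) py) w xy-w pw)
  where
  x-y : ⁅ x ⁆ y ≡ false
  x-y = insert-y (const false) (x≢y ∘ sym)
  xy-w : insert ⁅ x ⁆ y w ≡ false
  xy-w = trans (insert-y ⁅ x ⁆ (y≢w ∘ sym)) (insert-y (const false) (x≢w ∘ sym))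
  count-xy : count (insert ⁅ x ⁆ y) ≡ 2
  count-xy = trans (count-insert ⁅ x ⁆ y x-y) (cong suc (count-⁅⁆ x))

count≤1⇒unique : ∀ {n} {p : Fin n → Bool} → count p ≤ 1 →
  ∀ {x y} → p x ≡ true → p y ≡ true → x ≡ y
count≤1⇒unique h {x} {y} px py with x ≟ y
... | yes x≡y = x≡y
... | no  x≢y = ⊥-elim (<-irrefl refl (≤-trans (count≥2 x≢y px py) h))

lastOf : ∀ {A : Set} → A → List A → A
lastOf x []       = x
lastOf x (y ∷ ys) = lastOf y ys

lastOf-∈ : ∀ {A : Set} (x : A) xs → lastOf x xs ∈ x ∷ xs
lastOf-∈ x []       = here refl
lastOf-∈ x (y ∷ ys) = there (lastOf-∈ y ys)

module _ {A : Set} {_~_ : A → A → Set} (~-sym : ∀ {x y} → x ~ y → y ~ x) where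

  lastOf-neighbour : ∀ {x y ys} → Linked _~_ (x ∷ y ∷ ys) → ∃[ u ] (u ∈ x ∷ y ∷ ys × lastOf x (y ∷ ys) ~ u)
  lastOf-neighbour {x} {ys = []}    (x~y ∷ [-]) = x , here refl , ~-sym x~y
  lastOf-neighbour {ys = _ ∷ _} (_ ∷ l) = let u , u∈ , ~u = lastOf-neighbour l in u , there u∈ , ~u

  interior-neighbours : ∀ {x xs v} → Linked _~_ (x ∷ xs) → Unique (x ∷ xs) →
    v ∈ x ∷ xs → v ≢ x → v ≢ lastOf x xs →
    ∃[ u ] ∃[ w ] (u ∈ x ∷ xs × w ∈ x ∷ xs × u ≢ w × v ~ u × v ~ w)
  interior-neighbours _ _ (here v≡x) v≢x _ = ⊥-elim (v≢x v≡x)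
  interior-neighbours {xs = _ ∷ []} _ _ (there (here v≡y)) _ v≢last = ⊥-elim (v≢last v≡y)
  interior-neighbours {x} {_ ∷ w ∷ _} (x~y ∷ y~w ∷ _) uq (there (here refl)) _ _ =
    x , w , here refl , there (there (here refl)) , (λ x≡w → Unique[x∷xs]⇒x∉xs uq (there (here x≡w))) , ~-sym x~y , y~w
  interior-neighbours {xs = y ∷ ys} (_ ∷ l) uq (there (there v∈)) _ v≢last =
    let y∉ys = Unique[x∷xs]⇒x∉xs (AllPairs.tail uq)
        u , w , u∈ , w∈ , u≢w , v~u , v~w =
          interior-neighbours l (AllPairs.tail uq) (there v∈) (λ v≡y → y∉ys (subst (_∈ ys) v≡y v∈)) v≢last
    in u , w , there u∈ , there w∈ , u≢w , v~u , v~w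

lastOf≢head : ∀ {A : Set} {x : A} {xs v} → Unique (x ∷ xs) → v ∈ xs → lastOf x xs ≢ x
lastOf≢head {x = x} {y ∷ ys} uq _ last≡x = Unique[x∷xs]⇒x∉xs uq (subst (_∈ y ∷ ys) last≡x (lastOf-∈ y ys))

module DartGraph {nV nD : ℕ} (vert : Fin nD → Fin nV) (opp : Fin nD → Fin nD)
                 (opp-invol : ∀ d → opp (opp d) ≡ d) where

  target : Fin nD → Fin nV
  target d = vert (opp d)

  target-opp : ∀ d → target (opp d) ≡ vert d
  target-opp d = cong vert (opp-invol d)

  opp-injective : ∀ {d e} → opp d ≡ opp e → d ≡ e
  opp-injective {d} {e} p = trans (sym (opp-invol d)) (trans (cong opp p) (opp-invol e))

  Adj : Fin nV → Fin nV → Set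
  Adj u v = ∃[ d ] (vert d ≡ u × target d ≡ v)

  Adj-sym : ∀ {u v} → Adj u v → Adj v u
  Adj-sym (d , du , dv) = opp d , dv , trans (target-opp d) du

  data WalkVia (A : Fin nD → Set) : Fin nV → Fin nV → Set where
    stop : ∀ {v} → WalkVia A v v
    step : ∀ {w} d → A d → WalkVia A (target d) w → WalkVia A (vert d) w

  module _ {A : Fin nD → Set} where

    _++ʷ_ : ∀ {u v w} → WalkVia A u v → WalkVia A v w → WalkVia A u w
    stop         ++ʷ q = q
    step d a p   ++ʷ q = step d a (p ++ʷ q)

    castʷ : ∀ {u u′ v v′} → u ≡ u′ → v ≡ v′ → WalkVia A u v → WalkVia A u′ v′
    castʷ refl refl p = p

    reverseʷ : (∀ d → A d → A (opp d)) → ∀ {u v} → WalkVia A u v → WalkVia A v u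
    reverseʷ A-opp stop         = stop
    reverseʷ A-opp (step d a p) =
      reverseʷ A-opp p ++ʷ step (opp d) (A-opp d a) (castʷ refl (target-opp d) stop)

    mapʷ : ∀ {B : Fin nD → Set} → (∀ d → A d → B d) → ∀ {u v} → WalkVia A u v → WalkVia B u v
    mapʷ f stop         = stop
    mapʷ f (step d a p) = step d (f d a) (mapʷ f p)

  fromWalk : ∀ {u v} → Walk vert opp u v → WalkVia (const ⊤) u v
  fromWalk Walk.here       = stop
  fromWalk (Walk.step d w) = step d tt (fromWalk w)

  toWalk : ∀ {A u v} → WalkVia A u v → Walk vert opp u v
  toWalk stop         = Walk.here
  toWalk (step d _ p) = Walk.step d (toWalk p)

  Within : List (Fin nV) → Fin nD → Set
  Within xs d = vert d ∈ xs × target d ∈ xs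

  Within-opp : ∀ xs d → Within xs d → Within xs (opp d)
  Within-opp xs d (u∈ , v∈) = v∈ , subst (_∈ xs) (sym (target-opp d)) u∈

  walk-from-head : ∀ {x xs v} → Linked Adj (x ∷ xs) → v ∈ x ∷ xs → WalkVia (Within (x ∷ xs)) x v
  walk-from-head l (here refl) = stop
  walk-from-head {x} {y ∷ xs} ((d , dx , dy) ∷ l) (there v∈) =
    castʷ dx refl (step d (subst (_∈ _) (sym dx) (here refl) , subst (_∈ _) (sym dy) (there (here refl)))
      (castʷ (sym dy) refl (mapʷ (λ _ (u∈ , v∈) → there u∈ , there v∈) (walk-from-head l v∈))))

  walk-along : ∀ {xs u v} → Linked Adj xs → u ∈ xs → v ∈ xs → WalkVia (Within xs) u v
  walk-along {x ∷ xs} l u∈ v∈ = reverseʷ (Within-opp (x ∷ xs)) (walk-from-head l u∈) ++ʷ walk-from-head l v∈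

  Avoids : Fin nD → Fin nD → Set
  Avoids f g = g ≢ f × g ≢ opp f

  Avoids-opp : ∀ f g → Avoids f g → Avoids f (opp g)
  Avoids-opp f g (g≢f , g≢f′) =
    (λ e → g≢f′ (trans (sym (opp-invol g)) (cong opp e))) , (λ e → g≢f (opp-injective e))

  Avoids? : ∀ f g → Dec (Avoids f g)
  Avoids? f g = ¬? (g ≟ f) ×-dec ¬? (g ≟ opp f)

  Acyclic : Set
  Acyclic = ∀ f → ¬ WalkVia (Avoids f) (vert f) (target f)

  module _ (acyclic : Acyclic) where

    no-loop : ∀ e → vert e ≢ target e
    no-loop e loop = acyclic e (castʷ refl loop stop)

    end-dart-unique : ∀ {h R} → Linked Adj (h ∷ R) → Unique (h ∷ R) → ∀ {e e′} →
      vert e ≡ h → vert e′ ≡ h → target e ∈ h ∷ R → target e′ ∈ h ∷ R → e ≡ e′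
    end-dart-unique lk uq {e} e-h e′-h (here q) _ = ⊥-elim (no-loop e (trans e-h (sym q)))
    end-dart-unique lk uq {e′ = e′} e-h e′-h (there _) (here q) = ⊥-elim (no-loop e′ (trans e′-h (sym q)))
    end-dart-unique {h} {R} lk uq {e} {e′} e-h e′-h (there e∈R) (there e′∈R) with e ≟ e′
    ... | yes e≡e′ = e≡e′
    ... | no  e≢e′ = ⊥-elim (acyclic e (castʷ (trans e′-h (sym e-h)) refl
          (step e′ (e≢e′ ∘ sym , e′≢e*) (mapʷ avoids-e (walk-along (Linked.tail lk) e′∈R e∈R)))))
      where
      h∉R : h ∉ R
      h∉R = Unique[x∷xs]⇒x∉xs uq
      e′≢e* : e′ ≢ opp e
      e′≢e* q = h∉R (subst (_∈ R) (trans (sym (cong vert q)) e′-h) e∈R)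
      avoids-e : ∀ g → Within R g → Avoids e g
      avoids-e g (g∈ , g∈′) = (λ q → h∉R (subst (_∈ R) (trans (cong vert q) e-h) g∈))
                            , (λ q → h∉R (subst (_∈ R) (trans (cong target q) (trans (target-opp e) e-h)) g∈′))

    crossing-dart-unique : ∀ {X Y} → Linked Adj X → Linked Adj Y → All (_∉ X) Y → ∀ {z e} →
      vert z ∈ X → target z ∈ Y → vert e ∈ Y → target e ∈ X → e ≡ opp z
    crossing-dart-unique {X} {Y} lX lY Y∩X {z} {e} z∈X z∈Y e∈Y e∈X with e ≟ opp z
    ... | yes q = q
    ... | no  e≢z* = ⊥-elim (acyclic e
          (mapʷ avoids-Y (walk-along lY e∈Y z∈Y) ++ʷ
           step (opp z) (e≢z* ∘ sym , z*≢e*) (castʷ (sym (target-opp z)) refl (mapʷ avoids-X (walk-along lX z∈X e∈X)))))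
      where
      disjoint : ∀ {v} → v ∈ Y → v ∉ X
      disjoint = All-lookup Y∩X
      avoids-Y : ∀ g → Within Y g → Avoids e g
      avoids-Y g (g∈ , g∈′) = (λ q → disjoint (subst (_∈ Y) (cong target q) g∈′) e∈X)
                            , (λ q → disjoint (subst (_∈ Y) (cong vert q) g∈) e∈X)
      avoids-X : ∀ g → Within X g → Avoids e g
      avoids-X g (g∈ , g∈′) = (λ q → disjoint e∈Y (subst (_∈ X) (cong vert q) g∈))
                            , (λ q → disjoint e∈Y (subst (_∈ X) (trans (cong target q) (target-opp e)) g∈′))
      z*≢e* : opp z ≢ opp e
      z*≢e* q = disjoint e∈Y (subst (_∈ X) (cong vert (opp-injective q)) z∈X)

  module _ (opp-nofix : ∀ d → opp d ≢ d) (connected : ∀ u v → Walk vert opp u v)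
           (edges : nD + 2 ≡ 2 * nV) where

    record Subtree (r : Fin nV) (f : Fin nD) : Set where
      field
        S        : Fin nV → Bool
        D        : Fin nD → Bool
        D-inside : ∀ g → D g ≡ true → S (vert g) ≡ true × S (target g) ≡ true
        f∉D      : D f ≡ false
        r∈S      : S r ≡ true
        size     : count D + 2 ≡ 2 * count S

    Exit : (Fin nV → Bool) → Fin nD → Fin nD → Set
    Exit S f g = Avoids f g × S (vert g) ≡ true × S (target g) ≡ false

    Exit? : ∀ S f g → Dec (Exit S f g)
    Exit? S f g = Avoids? f g ×-dec (S (vert g) Bool.≟ true ×-dec S (target g) Bool.≟ false)

    extend-subtree : ∀ {r f} (t : Subtree r f) g → Exit (Subtree.S t) f g →
      ∃ λ (t′ : Subtree r f) → count (Subtree.S t) < count (Subtree.S t′)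
    extend-subtree {r} {f} t g ((g≢f , g≢f′) , g-in , g-out) =
      record { S = S′ ; D = D′ ; D-inside = D′-inside ; f∉D = f∉D′ ; r∈S = ⊆ᵇ-insert S x r r∈S ; size = size′ }
      , ≤-reflexive (sym (count-insert S x g-out))
      where
      open Subtree t
      x : Fin nV
      x = target g
      S′ : Fin nV → Bool
      S′ = insert S x
      D′ : Fin nD → Bool
      D′ = insert (insert D g) (opp g)
      not-in-D : ∀ h → S (vert h) ≡ false ⊎ S (target h) ≡ false → D h ≡ false
      not-in-D h out with D h in Dh
      ... | false = refl
      ... | true with D-inside h Dh | out
      ...   | (s , _) | inj₁ s′ = ⊥-elim (true≢false (trans (sym s) s′))
      ...   | (_ , s) | inj₂ s′ = ⊥-elim (true≢false (trans (sym s) s′))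
      count-D′ : count D′ ≡ 2 + count D
      count-D′ =
        trans (count-insert (insert D g) (opp g) (trans (insert-y D {g} {opp g} (opp-nofix g)) (not-in-D (opp g) (inj₁ g-out))))
              (cong suc (count-insert D g (not-in-D g (inj₂ g-out))))
      size′ : count D′ + 2 ≡ 2 * count S′
      size′ = begin
        count D′ + 2         ≡⟨ cong (λ m → m + 2) count-D′ ⟩
        2 + (count D + 2)    ≡⟨ cong (λ m → 2 + m) size ⟩
        2 + 2 * count S      ≡⟨ sym (*-suc 2 (count S)) ⟩
        2 * suc (count S)    ≡⟨ cong (2 *_) (sym (count-insert S x g-out)) ⟩
        2 * count S′         ∎
        where open ≡-Reasoning
      f∉D′ : D′ f ≡ false
      f∉D′ = trans (insert-y (insert D g) {opp g} {f} (λ f≡g′ → g≢f′ (trans (sym (opp-invol g)) (cong opp (sym f≡g′)))))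
             (trans (insert-y D {g} {f} (g≢f ∘ sym)) f∉D)
      D′-inside : ∀ h → D′ h ≡ true → S′ (vert h) ≡ true × S′ (target h) ≡ true
      D′-inside h e with insert≡true (insert D g) {opp g} {h} e
      ... | inj₁ refl = insert-x S x , ⊆ᵇ-insert S x _ (subst (λ v → S v ≡ true) (sym (target-opp g)) g-in)
      ... | inj₂ e′ with insert≡true D {g} {h} e′
      ...   | inj₁ refl = ⊆ᵇ-insert S x _ g-in , insert-x S x
      ...   | inj₂ Dh   = let (s , s′) = D-inside h Dh in ⊆ᵇ-insert S x _ s , ⊆ᵇ-insert S x _ s′

    -- Grow a subtree from vert f without the edge f: it reaches every vertex (by connectivity
    -- and the cycle), and then |D| + 2 = 2 nV = nD + 2 forces f ∈ D.
    tree-acyclic : Acyclic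
    tree-acyclic f cycle = bounded-rec (λ _ → ⊥) (count ∘ Subtree.S) (count≤n ∘ Subtree.S) grow root
      where
      r : Fin nV
      r = vert f

      avoid : ∀ {u v} → WalkVia (const ⊤) u v → WalkVia (Avoids f) u v
      avoid stop = stop
      avoid (step g _ p) with g ≟ f | g ≟ opp f
      ... | yes refl | _     = cycle ++ʷ avoid p
      ... | no _ | yes refl  = castʷ refl (sym (target-opp f)) (reverseʷ (Avoids-opp f) cycle) ++ʷ avoid p
      ... | no g≢f | no g≢f′ = step g (g≢f , g≢f′) (avoid p)

      closed⇒all : ∀ S → S r ≡ true → (∀ g → ¬ Exit S f g) → ∀ v → S v ≡ true
      closed⇒all S r∈S closed v = go (avoid (fromWalk (connected r v))) r∈S
        where
        go : ∀ {u v} → WalkVia (Avoids f) u v → S u ≡ true → S v ≡ true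
        go stop         s = s
        go (step g a p) s with S (target g) in e
        ... | true  = go p e
        ... | false = ⊥-elim (closed g (a , s , e))

      grow : (t : Subtree r f) → (∀ t′ → count (Subtree.S t) < count (Subtree.S t′) → ⊥) → ⊥
      grow t ih with any? (Exit? (Subtree.S t) f)
      ... | yes (g , exit) = let (t′ , grows) = extend-subtree t g exit in ih t′ grows
      ... | no none = <-irrefl count-D≡nD count-D<nD
        where
        open Subtree t
        count-S : count S ≡ nV
        count-S = count-all-true (closed⇒all S r∈S (λ g e → none (g , e)))
        count-D<nD : count D < nD
        count-D<nD = subst (count D <_) (count-all-true {p = const true} (λ _ → refl))
                           (count-mono-< (λ _ _ → refl) f f∉D refl)
        count-D≡nD : count D ≡ nD
        count-D≡nD = +-cancelʳ-≡ 2 (count D) nD (trans size (trans (cong (2 *_) count-S) (sym edges)))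

      root : Subtree r f
      root = record
        { S = ⁅ r ⁆ ; D = const false ; D-inside = λ _ () ; f∉D = refl ; r∈S = insert-x _ r
        ; size = trans (cong (λ m → m + 2) (count-∅ {nD})) (cong (2 *_) (sym (count-⁅⁆ r))) }

relink : ∀ {nV nD} (vert : Fin nD → Fin nV) o o-invol o′ o′-invol {xs} →
  (∀ {d} → vert d ∈ xs → vert (o d) ∈ xs → o′ d ≡ o d) →
  Linked (DartGraph.Adj vert o o-invol) xs → Linked (DartGraph.Adj vert o′ o′-invol) xs
relink vert o o-invol o′ o′-invol same []  = []
relink vert o o-invol o′ o′-invol same [-] = [-]
relink vert o o-invol o′ o′-invol same ((d , d-u , d-v) ∷ l) =
  (d , d-u , trans (cong vert (same (subst (_∈ _) (sym d-u) (here refl)) (subst (_∈ _) (sym d-v) (there (here refl))))) d-v)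
  ∷ relink vert o o-invol o′ o′-invol (λ u∈ v∈ → same (there u∈) (there v∈)) l

module Degrees {nV nD : ℕ} (vert : Fin nD → Fin nV) where

  at : Fin nV → Fin nD → Bool
  at v d = does (vert d ≟ v)

  deg : Fin nV → ℕ
  deg v = length (filterᵇ (at v) (allFin nD))

  Internal : Fin nV → Set
  Internal v = 2 ≤ deg v

  Internal? : ∀ v → Dec (Internal v)
  Internal? v = 2 ≤? deg v

  deg≡count : ∀ v → deg v ≡ count (at v)
  deg≡count v = length-filterᵇ-allFin (at v)

  at-true : ∀ {d v} → vert d ≡ v → at v d ≡ true
  at-true {d} {v} = dec-true (vert d ≟ v)

  at-true⁻¹ : ∀ {d v} → at v d ≡ true → vert d ≡ v
  at-true⁻¹ {d} {v} = dec-true⁻¹ (vert d ≟ v)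

  deg-pos : ∀ {d v} → vert d ≡ v → 1 ≤ deg v
  deg-pos {d} {v} d-v = subst (1 ≤_) (sym (deg≡count v)) (count-pos d (at-true d-v))

  dart-at : ∀ {v} → 1 ≤ deg v → ∃[ d ] vert d ≡ v
  dart-at {v} pos = let d , e = count-pos⇒∃ (subst (1 ≤_) (deg≡count v) pos) in d , at-true⁻¹ e

  leaf-dart-unique : ∀ {v d d′} → deg v ≡ 1 → vert d ≡ v → vert d′ ≡ v → d ≡ d′
  leaf-dart-unique {v} leaf d-v d′-v =
    count≤1⇒unique (≤-reflexive (trans (sym (deg≡count v)) leaf)) (at-true d-v) (at-true d′-v)

  other-dart : ∀ {v} → Internal v → ∀ e → ∃[ d ] (vert d ≡ v × d ≢ e)
  other-dart {v} int e =
    let d , d≢e , at-d = ∃-other e (subst (2 ≤_) (deg≡count v) int) in d , at-true⁻¹ at-d , d≢e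

  third-dart : ∀ {v} → 3 ≤ deg v → ∀ e e′ → ∃[ d ] (vert d ≡ v × d ≢ e × d ≢ e′)
  third-dart {v} deg≥3 e e′ =
    let d , d≢e , d≢e′ , at-d = ∃-third e e′ (subst (3 ≤_) (deg≡count v) deg≥3)
    in d , at-true⁻¹ at-d , d≢e , d≢e′

  three-darts : ∀ {v a b c} → vert a ≡ v → vert b ≡ v → vert c ≡ v → a ≢ b → a ≢ c → b ≢ c → 3 ≤ deg v
  three-darts {v} a-v b-v c-v a≢b a≢c b≢c =
    subst (3 ≤_) (sym (deg≡count v)) (count≥3 a≢b a≢c b≢c (at-true a-v) (at-true b-v) (at-true c-v))

  Internal⇒¬leaf : ∀ {v} → Internal v → deg v ≢ 1
  Internal⇒¬leaf int leaf = <-irrefl refl (subst (2 ≤_) leaf int)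

  ¬Internal⇒leaf : ∀ {d v} → vert d ≡ v → ¬ Internal v → deg v ≡ 1
  ¬Internal⇒leaf d-v ¬int = ≤-antisym (≤-pred (≰⇒> ¬int)) (deg-pos d-v)

  leaf≢internal : ∀ {u v} → deg u ≡ 1 → Internal v → u ≢ v
  leaf≢internal leaf int refl = Internal⇒¬leaf int leaf

module Paths {nV nD : ℕ} (vert : Fin nD → Fin nV) (opp : Fin nD → Fin nD)
             (opp-invol : ∀ d → opp (opp d) ≡ d) where
  open DartGraph vert opp opp-invol
  open Degrees vert
  open import Data.List.Membership.DecPropositional (_≟_ {n = nV}) using (_∈?_)

  Tip : Fin nV → Set
  Tip w = ∀ {e e′} → vert e ≡ w → vert e′ ≡ w → Internal (target e) → Internal (target e′) → e ≡ e′

  internal-tip-leaf : ∀ {w} → Internal w → Tip w → ∃[ g ] (vert g ≡ w × ¬ Internal (target g))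
  internal-tip-leaf {w} int tip with dart-at (≤-trans (s≤s z≤n) int)
  ... | e , e-w with other-dart int e
  ... | e′ , e′-w , e′≢e with Internal? (target e) | Internal? (target e′)
  ... | no ¬i | _      = e , e-w , ¬i
  ... | yes _ | no ¬i′ = e′ , e′-w , ¬i′
  ... | yes i | yes i′ = ⊥-elim (e′≢e (tip e′-w e-w i′ i))

  another-leaf : ∀ {w} → Tip w → 3 ≤ deg w → ∀ g →
    ∃[ g′ ] (vert g′ ≡ w × g′ ≢ g × ¬ Internal (target g′))
  another-leaf {w} tip deg≥3 g with other-dart (≤-trans (s≤s (s≤s z≤n)) deg≥3) g
  ... | e , e-w , e≢g with third-dart deg≥3 g e
  ... | e′ , e′-w , e′≢g , e′≢e with Internal? (target e) | Internal? (target e′)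
  ... | no ¬i | _      = e , e-w , e≢g , ¬i
  ... | yes _ | no ¬i′ = e′ , e′-w , e′≢g , ¬i′
  ... | yes i | yes i′ = ⊥-elim (e′≢e (tip e′-w e-w i′ i))

  leaf-targets-distinct : ∀ {g g′} → g ≢ g′ → deg (target g) ≡ 1 → target g ≢ target g′
  leaf-targets-distinct {g} {g′} g≢g′ leaf same = g≢g′ (opp-injective (leaf-dart-unique leaf refl (sym same)))

  interior-deg≥3 : ∀ {h R} → Linked Adj (h ∷ R) → Unique (h ∷ R) → ∀ {z} →
    vert z ∈ h ∷ R → target z ∉ h ∷ R → vert z ≢ h → vert z ≢ lastOf h R → 3 ≤ deg (vert z)
  interior-deg≥3 {h} {R} lk uq {z} z∈ z∉ z≢h z≢end
    with interior-neighbours Adj-sym lk uq z∈ z≢h z≢end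
  ... | u , w , u∈ , w∈ , u≢w , (d , d-z , d-u) , (d′ , d′-z , d′-w) =
    three-darts refl d-z d′-z (λ q → z∉ (subst (_∈ h ∷ R) (sym (trans (cong target q) d-u)) u∈))
                              (λ q → z∉ (subst (_∈ h ∷ R) (sym (trans (cong target q) d′-w)) w∈))
                              (λ q → u≢w (trans (sym d-u) (trans (cong target q) d′-w)))

  -- Paths grow at `first`; `end` is the far endpoint, which never moves.
  record InternalPath (F : List (Fin nV)) : Set where
    constructor mkPath
    field
      first    : Fin nV
      rest     : List (Fin nV)
      unique   : Unique (first ∷ rest)
      linked   : Linked Adj (first ∷ rest)
      internal : All Internal (first ∷ rest)
      avoids   : All (_∉ F) (first ∷ rest)

    vertices : List (Fin nV)
    vertices = first ∷ rest

    end : Fin nV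
    end = lastOf first rest

  open InternalPath

  Grows : ∀ {F} → InternalPath F → Fin nD → Set
  Grows {F} P e = vert e ≡ first P × Internal (target e) × target e ∉ F × target e ∉ vertices P

  Grows? : ∀ {F} (P : InternalPath F) e → Dec (Grows P e)
  Grows? {F} P e = vert e ≟ first P ×-dec Internal? (target e) ×-dec ¬? (target e ∈? F) ×-dec ¬? (target e ∈? vertices P)

  record Extension {F} (P : InternalPath F) : Set where
    field
      extended : InternalPath F
      maximal  : ∀ {e} → vert e ≡ first extended → Internal (target e) →
                 target e ∈ F ⊎ target e ∈ vertices extended
      same-end : end extended ≡ end P
      extends  : ∀ {v} → v ∈ vertices P → v ∈ vertices extended
      fresh    : vertices extended ≡ vertices P ⊎ first extended ∉ vertices P

  extension-grows : ∀ {F} {P : InternalPath F} (X : Extension P) → ∀ {e} → Grows P e →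
    first (Extension.extended X) ∉ vertices P
  extension-grows X (e-first , int , e∉F , e∉P) with Extension.fresh X
  ... | inj₂ new = new
  ... | inj₁ refl with Extension.maximal X e-first int
  ...   | inj₁ e∈F = ⊥-elim (e∉F e∈F)
  ...   | inj₂ e∈P = ⊥-elim (e∉P e∈P)

  mem : List (Fin nV) → Fin nV → Bool
  mem xs v = does (v ∈? xs)

  extend : ∀ {F} (P : InternalPath F) → Extension P
  extend {F} = bounded-rec Extension (count ∘ mem ∘ vertices) (count≤n ∘ mem ∘ vertices) extend-step
    where
    extend-step : ∀ P → (∀ P′ → count (mem (vertices P)) < count (mem (vertices P′)) → Extension P′) → Extension P
    extend-step P ih with any? (Grows? P)
    ... | no stuck = record
      { extended = P ; maximal = maximal ; same-end = refl ; extends = id ; fresh = inj₁ refl }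
      where
      maximal : ∀ {e} → vert e ≡ first P → Internal (target e) → target e ∈ F ⊎ target e ∈ vertices P
      maximal {e} e-first int with target e ∈? F | target e ∈? vertices P
      ... | yes e∈F | _       = inj₁ e∈F
      ... | no _    | yes e∈P = inj₂ e∈P
      ... | no e∉F  | no e∉P  = ⊥-elim (stuck (e , e-first , int , e∉F , e∉P))
    ... | yes (e , e-first , int , e∉F , e∉P) = lift (ih P′ more)
      where
      P′ : InternalPath F
      P′ = mkPath (target e) (vertices P) (¬Any⇒All¬ _ e∉P ∷ unique P)
                ((opp e , refl , trans (target-opp e) e-first) ∷ linked P) (int ∷ internal P) (e∉F ∷ avoids P)
      more : count (mem (vertices P)) < count (mem (vertices P′))
      more = count-mono-< (λ v v∈ → dec-true (v ∈? vertices P′) (there (dec-true⁻¹ (v ∈? vertices P) v∈)))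
                          (target e) (dec-false (target e ∈? vertices P) e∉P) (dec-true (target e ∈? vertices P′) (here refl))
      lift : Extension P′ → Extension P
      lift X = record
        { extended = extended ; maximal = maximal ; same-end = same-end ; extends = extends ∘ there
        ; fresh = inj₂ (λ new∈P → [ (λ eq → e∉P (subst (_∈ vertices P) (∷-injectiveˡ eq) new∈P))
                                   , (λ new∉P′ → new∉P′ (there new∈P)) ] fresh) }
        where open Extension X

  stuck-head-tip : Acyclic → ∀ {F} (P : InternalPath F) →
    (∀ {e} → vert e ≡ first P → Internal (target e) → target e ∈ vertices P) → Tip (first P)
  stuck-head-tip acyclic P stuck e-h e′-h int int′ =
    end-dart-unique acyclic (linked P) (unique P) e-h e′-h (stuck e-h int) (stuck e′-h int′)

  tip-end-stuck : ∀ {h R} → Linked Adj (h ∷ R) → All Internal (h ∷ R) → Tip (lastOf h R) →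
    (∀ {e} → vert e ≡ h → Internal (target e) → target e ∈ h ∷ R) →
    ∀ {e} → vert e ≡ lastOf h R → Internal (target e) → target e ∈ h ∷ R
  tip-end-stuck {R = []}    _  _   _   stuck = stuck
  tip-end-stuck {R = _ ∷ _} lk int tip _ {e} e-end int-e with lastOf-neighbour Adj-sym lk
  ... | u , u∈ , (d , d-end , d-u) =
    subst (_∈ _) (trans (sym d-u) (cong target (tip d-end e-end (subst Internal (sym d-u) (All-lookup int u∈)) int-e))) u∈

  maximal-path : ∀ {v} → Internal v → Σ (InternalPath []) λ Q →
    end Q ≡ v × (∀ {e} → vert e ≡ first Q → Internal (target e) → target e ∈ vertices Q)
  maximal-path {v} int =
    extended , same-end , λ e-first int′ → [ (λ ()) , id ] (maximal e-first int′)
    where open Extension (extend {F = []} (mkPath v [] ([] ∷ []) [-] (int ∷ []) ((λ ()) ∷ [])))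

  Closed : List (Fin nV) → Set
  Closed xs = ∀ {d} → vert d ∈ xs → Internal (target d) → target d ∈ xs

  closed⇒internal∈ : (∀ u v → Walk vert opp u v) → ∀ {p xs} → p ∈ xs → Closed xs →
    ∀ {v} → Internal v → v ∈ xs
  closed⇒internal∈ connected {p} {xs} p∈ closed {v} int =
    [ id , (λ (leaf , _) → ⊥-elim (Internal⇒¬leaf int leaf)) ] (reach (fromWalk (connected p v)) (inj₁ p∈))
    where
    Near : Fin nV → Set
    Near u = u ∈ xs ⊎ (deg u ≡ 1 × ∀ {d} → vert d ≡ u → target d ∈ xs)
    reach : ∀ {u w} → WalkVia (const ⊤) u w → Near u → Near w
    reach stop near = near
    reach (step d _ p) (inj₂ (_ , nbr)) = reach p (inj₁ (nbr refl))
    reach (step d _ p) (inj₁ d∈) with Internal? (target d)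
    ... | yes int′ = reach p (inj₁ (closed d∈ int′))
    ... | no ¬int  = reach p (inj₂ (leaf , λ d′-at →
          subst (_∈ xs) (sym (trans (cong target (leaf-dart-unique leaf d′-at refl)) (target-opp d))) d∈))
      where
      leaf : deg (target d) ≡ 1
      leaf = ¬Internal⇒leaf {opp d} refl ¬int

-- The hypotheses say that the edges of xa, xb and z are pairwise distinct.
module GlueCutOpp {nD : ℕ} (opp : Fin nD → Fin nD)
  (opp-invol : ∀ d → opp (opp d) ≡ d) (opp-nofix : ∀ d → opp d ≢ d) (xa xb z : Fin nD)
  (xa≢xb : xa ≢ xb) (xa≢xb* : xa ≢ opp xb) (xa≢z : xa ≢ z) (xa≢z* : xa ≢ opp z)
  (xb≢z : xb ≢ z) (xb≢z* : xb ≢ opp z) where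

  opp′ : Fin nD → Fin nD
  opp′ = gcOpp opp xa xb z

  private
    flip : ∀ {d e} → d ≢ opp e → opp d ≢ e
    flip {d} d≢e* q = d≢e* (trans (sym (opp-invol d)) (cong opp q))

    opp-≢ : ∀ {d e} → d ≢ e → opp d ≢ opp e
    opp-≢ {d} {e} d≢e q = d≢e (trans (sym (opp-invol d)) (trans (cong opp q) (opp-invol e)))

    sym≢ : ∀ {d e : Fin nD} → d ≢ e → e ≢ d
    sym≢ d≢e = d≢e ∘ sym

  -- The local `oppG` of gcOpp: the glued graph, in which opp xa and opp xb are paired.
  glued : Fin nD → Fin nD
  glued e = if does (e ≟ opp xa) then opp xb else if does (e ≟ opp xb) then opp xa else opp e

  glued-other : ∀ {e} → e ≢ opp xa → e ≢ opp xb → glued e ≡ opp e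
  glued-other {e} e≢ya e≢yb = trans (if-≟-no {x = e} {y = opp xa} e≢ya) (if-≟-no {x = e} {y = opp xb} e≢yb)

  glued-z : glued z ≡ opp z
  glued-z = glued-other (sym≢ (flip xa≢z*)) (sym≢ (flip xb≢z*))

  opp′-xa : opp′ xa ≡ z
  opp′-xa = if-≟-yes {x = xa} {y = xa} refl

  opp′-xb : opp′ xb ≡ opp z
  opp′-xb = trans (if-≟-no {x = xb} {y = xa} (sym≢ xa≢xb)) (trans (if-≟-yes {x = xb} {y = xb} refl) glued-z)

  opp′-z : opp′ z ≡ xa
  opp′-z = trans (if-≟-no {x = z} {y = xa} (sym≢ xa≢z)) (trans (if-≟-no {x = z} {y = xb} (sym≢ xb≢z))
           (if-≟-yes {x = z} {y = z} refl))

  opp′-z* : opp′ (opp z) ≡ xb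
  opp′-z* = trans (if-≟-no {x = opp z} {y = xa} (sym≢ xa≢z*)) (trans (if-≟-no {x = opp z} {y = xb} (sym≢ xb≢z*))
           (trans (if-≟-no {x = opp z} {y = z} (opp-nofix z))
           (if-≟-yes {x = opp z} {y = glued z} (sym glued-z))))

  opp′-away : ∀ {d} → d ≢ xa → d ≢ xb → d ≢ z → d ≢ opp z → opp′ d ≡ glued d
  opp′-away {d} d≢xa d≢xb d≢z d≢z* =
    trans (if-≟-no {x = d} {y = xa} d≢xa) (trans (if-≟-no {x = d} {y = xb} d≢xb)
      (trans (if-≟-no {x = d} {y = z} d≢z) (if-≟-no {x = d} {y = glued z} (λ q → d≢z* (trans q glued-z)))))

  opp′-ya : opp′ (opp xa) ≡ opp xb
  opp′-ya = trans (opp′-away (opp-nofix xa) (flip xa≢xb*) (flip xa≢z*) (opp-≢ xa≢z))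
                (if-≟-yes {x = opp xa} {y = opp xa} refl)

  opp′-yb : opp′ (opp xb) ≡ opp xa
  opp′-yb = trans (opp′-away (sym≢ xa≢xb*) (opp-nofix xb) (flip xb≢z*) (opp-≢ xb≢z))
                (trans (if-≟-no {x = opp xb} {y = opp xa} (opp-≢ (sym≢ xa≢xb))) (if-≟-yes {x = opp xb} {y = opp xb} refl))

  data Kind (d : Fin nD) : Set where
    is-xa : d ≡ xa → Kind d
    is-xb : d ≡ xb → Kind d
    is-z  : d ≡ z → Kind d
    is-z* : d ≡ opp z → Kind d
    is-ya : d ≡ opp xa → Kind d
    is-yb : d ≡ opp xb → Kind d
    unaffected : d ≢ xa → d ≢ xb → d ≢ z → d ≢ opp z → d ≢ opp xa → d ≢ opp xb → Kind d

  kind : ∀ d → Kind d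
  kind d with d ≟ xa | d ≟ xb | d ≟ z | d ≟ opp z | d ≟ opp xa | d ≟ opp xb
  ... | yes q | _     | _     | _     | _     | _     = is-xa q
  ... | no _  | yes q | _     | _     | _     | _     = is-xb q
  ... | no _  | no _  | yes q | _     | _     | _     = is-z q
  ... | no _  | no _  | no _  | yes q | _     | _     = is-z* q
  ... | no _  | no _  | no _  | no _  | yes q | _     = is-ya q
  ... | no _  | no _  | no _  | no _  | no _  | yes q = is-yb q
  ... | no n₁ | no n₂ | no n₃ | no n₄ | no n₅ | no n₆ = unaffected n₁ n₂ n₃ n₄ n₅ n₆

  opp′-unaffected : ∀ {d} → d ≢ xa → d ≢ xb → d ≢ z → d ≢ opp z → d ≢ opp xa → d ≢ opp xb →
    opp′ d ≡ opp d
  opp′-unaffected n₁ n₂ n₃ n₄ n₅ n₆ = trans (opp′-away n₁ n₂ n₃ n₄) (glued-other n₅ n₆)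

  opp′-invol : ∀ d → opp′ (opp′ d) ≡ d
  opp′-invol d with kind d
  ... | is-xa refl = trans (cong opp′ opp′-xa) opp′-z
  ... | is-xb refl = trans (cong opp′ opp′-xb) opp′-z*
  ... | is-z  refl = trans (cong opp′ opp′-z) opp′-xa
  ... | is-z* refl = trans (cong opp′ opp′-z*) opp′-xb
  ... | is-ya refl = trans (cong opp′ opp′-ya) opp′-yb
  ... | is-yb refl = trans (cong opp′ opp′-yb) opp′-ya
  ... | unaffected n₁ n₂ n₃ n₄ n₅ n₆ =
    trans (cong opp′ (opp′-unaffected n₁ n₂ n₃ n₄ n₅ n₆))
      (trans (opp′-unaffected (flip n₅) (flip n₆) (flip n₄) (opp-≢ n₃) (opp-≢ n₁) (opp-≢ n₂)) (opp-invol d))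

  opp′-nofix : ∀ d → opp′ d ≢ d
  opp′-nofix d with kind d
  ... | is-xa refl = λ q → xa≢z (sym (trans (sym opp′-xa) q))
  ... | is-xb refl = λ q → xb≢z* (sym (trans (sym opp′-xb) q))
  ... | is-z  refl = λ q → xa≢z (trans (sym opp′-z) q)
  ... | is-z* refl = λ q → xb≢z* (trans (sym opp′-z*) q)
  ... | is-ya refl = λ q → opp-≢ xa≢xb (sym (trans (sym opp′-ya) q))
  ... | is-yb refl = λ q → opp-≢ xa≢xb (trans (sym opp′-yb) q)
  ... | unaffected n₁ n₂ n₃ n₄ n₅ n₆ =
    λ q → opp-nofix d (trans (sym (opp′-unaffected n₁ n₂ n₃ n₄ n₅ n₆)) q)

module _ {nV nD : ℕ} (T : DTree nV nD) where
  open DTree T using (vert; L; L-leaf; μ; ℓ)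
  open Degrees vert

  L̄-leaf : Fin nV → Bool
  L̄-leaf v = not (L v) ∧ (deg v ≡ᵇ 1)

  μ≡count : μ 1 ≡ count L̄-leaf
  μ≡count = length-filterᵇ-allFin L̄-leaf

  is-L̄-leaf : ∀ {v} → L v ≡ false → deg v ≡ 1 → L̄-leaf v ≡ true
  is-L̄-leaf L̄ leaf rewrite L̄ | leaf = refl

  record Rewiring : Set where
    field
      opp       : Fin nD → Fin nD
      opp-invol : ∀ d → opp (opp d) ≡ d
      opp-nofix : ∀ d → opp d ≢ d
      connected : ∀ u v → Walk vert opp u v

  rewire : Rewiring → DTree nV nD
  rewire r = record
    { tree = record
      { vert = vert ; opp = opp ; rot = rot ; rot⁻¹ = rot⁻¹ ; opp-invol = opp-invol ; opp-nofix = opp-nofix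
      ; rot-inv₁ = rot-inv₁ ; rot-inv₂ = rot-inv₂ ; rot-vert = rot-vert ; rot-cyc = rot-cyc
      ; vert-surj = vert-surj ; connected = connected ; edges = edges }
    ; L = L ; L-leaf = L-leaf }
    where
    open Rewiring r
    open DTree T using (rot; rot⁻¹; rot-inv₁; rot-inv₂; rot-vert; rot-cyc; vert-surj; edges)

  -- `rewire initial` is T itself, by eta for records.
  initial : Rewiring
  initial = record
    { opp = DTree.opp T ; opp-invol = DTree.opp-invol T ; opp-nofix = DTree.opp-nofix T ; connected = DTree.connected T }

  module Graph (r : Rewiring) where
    open Rewiring r public
    open DartGraph vert opp opp-invol public
    open Paths vert opp opp-invol public

    acyclic : Acyclic
    acyclic = tree-acyclic opp-nofix connected (DTree.edges T)

    NiceLeaf : Set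
    NiceLeaf = ∀ v → L v ≡ false → deg v ≡ 1 → ∃[ w ] (Adj v w × (∀ u → deg u ≤ deg w))

    L̄-leaf-neighbour-max : NiceLeaf → ∀ {g} → L (target g) ≡ false → deg (target g) ≡ 1 →
      ∀ u → deg u ≤ deg (vert g)
    L̄-leaf-neighbour-max nice {g} L̄ leaf u with nice (target g) L̄ leaf
    ... | w , (d , d-at , d-w) , max =
      subst (λ v → deg u ≤ deg v)
            (trans (sym d-w) (trans (cong target (leaf-dart-unique leaf d-at refl)) (target-opp g))) (max u)

  nice-initial : DTree.Nice T → Graph.NiceLeaf initial
  nice-initial (inj₂ (_ , nice)) = nice
  nice-initial (inj₁ μ₁≡0) v L̄ leaf =
    ⊥-elim (true≢false (trans (sym (is-L̄-leaf L̄ leaf)) (count≡0⇒false (trans (sym μ≡count) μ₁≡0) v)))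

  nice-rewired : DTree.Nice T → ∀ r → Graph.NiceLeaf r → DTree.Nice (rewire r)
  nice-rewired (inj₁ μ₁≡0)        _ _    = inj₁ μ₁≡0
  nice-rewired (inj₂ (μ₁≡1 , _)) _ nice = inj₂ (μ₁≡1 , nice)

  module _ (μ₁≤1 : μ 1 ≤ 1) where

    L̄-leaf-unique : ∀ {u w} → L u ≡ false → deg u ≡ 1 → L w ≡ false → deg w ≡ 1 → u ≡ w
    L̄-leaf-unique L̄u leaf-u L̄w leaf-w =
      count≤1⇒unique (subst (_≤ 1) μ≡count μ₁≤1) (is-L̄-leaf L̄u leaf-u) (is-L̄-leaf L̄w leaf-w)

    -- If the leaf found is the L̄-leaf, niceness makes its neighbour w of maximal degree, so
    -- deg w ≥ 3 and w has a second leaf, an L-leaf because μ₁ ≤ 1.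
    tip-L-leaf : ∀ r → Graph.NiceLeaf r → ∀ {u} → 3 ≤ deg u → ∀ {w} → Internal w → Graph.Tip r w →
      ∃[ g ] (vert g ≡ w × L (Graph.target r g) ≡ true)
    tip-L-leaf r nice {u} deg-u {w} int tip = pick (internal-tip-leaf int tip)
      where
      open Graph r
      Found : Set
      Found = ∃[ g ] (vert g ≡ w × L (target g) ≡ true)
      pick : ∃[ g ] (vert g ≡ w × ¬ Internal (target g)) → Found
      pick (g , g-w , ¬int) with L (target g) in Lg
      ... | true  = g , g-w , Lg
      ... | false = pick-other (another-leaf tip w≥3 g)
        where
        leaf : deg (target g) ≡ 1
        leaf = ¬Internal⇒leaf {opp g} refl ¬int
        w≥3 : 3 ≤ deg w
        w≥3 = ≤-trans deg-u (subst (λ v → deg u ≤ deg v) g-w (L̄-leaf-neighbour-max nice Lg leaf u))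
        pick-other : ∃[ g′ ] (vert g′ ≡ w × g′ ≢ g × ¬ Internal (target g′)) → Found
        pick-other (g′ , g′-w , g′≢g , ¬int′) with L (target g′) in Lg′
        ... | true  = g′ , g′-w , Lg′
        ... | false = ⊥-elim (leaf-targets-distinct g′≢g leaf′ (L̄-leaf-unique Lg′ leaf′ Lg leaf))
          where
          leaf′ : deg (target g′) ≡ 1
          leaf′ = ¬Internal⇒leaf {opp g′} refl ¬int′

  open import Data.List.Membership.DecPropositional (_≟_ {n = nV}) using (_∈?_)

  record Spine (r : Rewiring) : Set where
    open Graph r
    field
      path : InternalPath []
    open InternalPath path
    field
      head-stuck : ∀ {e} → vert e ≡ first → Internal (target e) → target e ∈ vertices
      end-tip    : Tip end

  Reached : Rewiring → List (Fin nV) → Fin nV → Set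
  Reached r ps v = ∃[ d ] (vert d ≡ v × Graph.target r d ∈ ps)

  Unreached : Rewiring → List (Fin nV) → Fin nV → Set
  Unreached r ps v = deg v ≡ 1 × ¬ Reached r ps v

  Unreached? : ∀ r ps v → Dec (Unreached r ps v)
  Unreached? r ps v = deg v ℕ.≟ 1 ×-dec ¬? (any? λ d → vert d ≟ v ×-dec Graph.target r d ∈? ps)

  unreached : Rewiring → List (Fin nV) → ℕ
  unreached r ps = count (λ v → does (Unreached? r ps v))

  unreached-mono : ∀ {r r′ ps ps′} → (∀ {v} → Unreached r′ ps′ v → Unreached r ps v) →
    unreached r′ ps′ ≤ unreached r ps
  unreached-mono {r} {r′} {ps} {ps′} sub =
    count-mono λ v u → dec-true (Unreached? r ps v) (sub (dec-true⁻¹ (Unreached? r′ ps′ v) u))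

  unreached-mono-< : ∀ {r r′ ps ps′} → (∀ {v} → Unreached r′ ps′ v → Unreached r ps v) →
    ∀ v → ¬ Unreached r′ ps′ v → Unreached r ps v → unreached r′ ps′ < unreached r ps
  unreached-mono-< {r} {r′} {ps} {ps′} sub v ¬u′ u =
    count-mono-< (λ w e → dec-true (Unreached? r ps w) (sub (dec-true⁻¹ (Unreached? r′ ps′ w) e)))
                 v (dec-false (Unreached? r′ ps′ v) ¬u′) (dec-true (Unreached? r ps v) u)

  unreached≤ℓ+μ₁ : ∀ r ps → unreached r ps ≤ ℓ + μ 1
  unreached≤ℓ+μ₁ r ps = subst₂ (λ m n → unreached r ps ≤ m + n) (sym (length-filterᵇ-allFin L)) (sym μ≡count)
    (count-∪ L-or-L̄)
    where
    L-or-L̄ : ∀ v → does (Unreached? r ps v) ≡ true → L v ≡ true ⊎ L̄-leaf v ≡ true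
    L-or-L̄ v e with dec-true⁻¹ (Unreached? r ps v) e | L v
    ... | _ , _    | true  = inj₁ refl
    ... | leaf , _ | false rewrite leaf = inj₂ refl

  -- The step: glue the L-leaf a at the head h of the spine P with the L-leaf b at the head c
  -- of the branch B through x = target z, and cut the edge of z.
  module Move (r : Rewiring) (P : Graph.InternalPath r [])
    (z : Fin nD) (z∈P : vert z ∈ Graph.InternalPath.vertices r P) (z∉P : Graph.target r z ∉ Graph.InternalPath.vertices r P)
    (B : Graph.InternalPath r (Graph.InternalPath.vertices r P)) (x∈B : Graph.target r z ∈ Graph.InternalPath.vertices r B)
    (gh : Fin nD) (gh-h : vert gh ≡ Graph.InternalPath.first {r} P) (L-gh : L (Graph.target r gh) ≡ true)
    (gc : Fin nD) (gc-c : vert gc ≡ Graph.InternalPath.first {r} B) (L-gc : L (Graph.target r gc) ≡ true) where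
    open Graph r

    open InternalPath P using () renaming (vertices to ps; first to h; internal to ps-internal; linked to ps-linked)
    open InternalPath B using ()
      renaming (vertices to cB; first to c; internal to cB-internal; linked to cB-linked; avoids to cB-avoids)

    private
      y x a b : Fin nV
      y = vert z
      x = target z
      a = target gh
      b = target gc
      xa xb : Fin nD
      xa = opp gh
      xb = opp gc

      leaf-a : deg a ≡ 1
      leaf-a = L-leaf a L-gh
      leaf-b : deg b ≡ 1
      leaf-b = L-leaf b L-gc
      int-h : Internal h
      int-h = All-lookup ps-internal (here refl)
      int-c : Internal c
      int-c = All-lookup cB-internal (here refl)
      int-y : Internal y
      int-y = All-lookup ps-internal z∈P
      int-x : Internal x
      int-x = All-lookup cB-internal x∈B
      c∉P : c ∉ ps
      c∉P = All-lookup cB-avoids (here refl)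
      leaf∉ : ∀ {v xs} → All Internal xs → deg v ≡ 1 → v ∉ xs
      leaf∉ int leaf v∈ = Internal⇒¬leaf (All-lookup int v∈) leaf
      ya-h : vert (opp xa) ≡ h
      ya-h = trans (cong vert (opp-invol gh)) gh-h
      yb-c : vert (opp xb) ≡ c
      yb-c = trans (cong vert (opp-invol gc)) gc-c
      a≢b : a ≢ b
      a≢b a≡b = c∉P (subst (_∈ ps) h≡c (here refl))
        where
        h≡c : h ≡ c
        h≡c = trans (sym ya-h) (trans (cong (vert ∘ opp) (leaf-dart-unique leaf-a refl (sym a≡b))) yb-c)
      via-vert : ∀ {d e} → vert d ≢ vert e → d ≢ e
      via-vert n = n ∘ cong vert
      xa≢xb : xa ≢ xb
      xa≢xb = via-vert a≢b
      xa≢xb* : xa ≢ opp xb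
      xa≢xb* = via-vert (λ q → leaf≢internal leaf-a int-c (trans q yb-c))
      xa≢z : xa ≢ z
      xa≢z = via-vert (leaf≢internal leaf-a int-y)
      xa≢z* : xa ≢ opp z
      xa≢z* = via-vert (leaf≢internal leaf-a int-x)
      xb≢z : xb ≢ z
      xb≢z = via-vert (leaf≢internal leaf-b int-y)
      xb≢z* : xb ≢ opp z
      xb≢z* = via-vert (leaf≢internal leaf-b int-x)

    open GlueCutOpp opp opp-invol opp-nofix xa xb z xa≢xb xa≢xb* xa≢z xa≢z* xb≢z xb≢z* public

    private
      in-both : ∀ {v} → v ∈ cB → v ∈ ps → ⊥
      in-both = All-lookup cB-avoids
      a-is : ∀ {d} → d ≡ opp xa → target d ≡ a
      a-is refl = cong vert (opp-invol xa)

    unchanged-in-ps : ∀ {d} → vert d ∈ ps → target d ∈ ps → opp′ d ≡ opp d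
    unchanged-in-ps {d} d∈ d∈′ with kind d
    ... | is-xa refl = ⊥-elim (leaf∉ ps-internal leaf-a d∈)
    ... | is-xb refl = ⊥-elim (leaf∉ ps-internal leaf-b d∈)
    ... | is-z  refl = ⊥-elim (z∉P d∈′)
    ... | is-z* refl = ⊥-elim (z∉P d∈)
    ... | is-ya q    = ⊥-elim (leaf∉ ps-internal leaf-a (subst (_∈ ps) (a-is q) d∈′))
    ... | is-yb refl = ⊥-elim (c∉P (subst (_∈ ps) yb-c d∈))
    ... | unaffected n₁ n₂ n₃ n₄ n₅ n₆ = opp′-unaffected n₁ n₂ n₃ n₄ n₅ n₆

    unchanged-in-cB : ∀ {d} → vert d ∈ cB → target d ∈ cB → opp′ d ≡ opp d
    unchanged-in-cB {d} d∈ d∈′ with kind d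
    ... | is-xa refl = ⊥-elim (leaf∉ cB-internal leaf-a d∈)
    ... | is-xb refl = ⊥-elim (leaf∉ cB-internal leaf-b d∈)
    ... | is-z  refl = ⊥-elim (in-both d∈ z∈P)
    ... | is-z* refl = ⊥-elim (in-both (subst (_∈ cB) (target-opp z) d∈′) z∈P)
    ... | is-ya refl = ⊥-elim (in-both (subst (_∈ cB) ya-h d∈) (here refl))
    ... | is-yb refl = ⊥-elim (leaf∉ cB-internal leaf-b (subst (_∈ cB) (cong vert (opp-invol xb)) d∈′))
    ... | unaffected n₁ n₂ n₃ n₄ n₅ n₆ = opp′-unaffected n₁ n₂ n₃ n₄ n₅ n₆

    ps-linked′ : Linked (DartGraph.Adj vert opp′ opp′-invol) ps
    ps-linked′ = relink vert opp opp-invol opp′ opp′-invol unchanged-in-ps ps-linked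

    private
      module G′ = DartGraph vert opp′ opp′-invol
      Walk′ : Fin nV → Fin nV → Set
      Walk′ = G′.WalkVia (const ⊤)
      rev′ : ∀ {u v} → Walk′ u v → Walk′ v u
      rev′ = G′.reverseʷ (λ _ _ → _)
      y⇝h : Walk′ y h
      y⇝h = G′.mapʷ _ (G′.walk-along ps-linked′ z∈P (here refl))
      x⇝c : Walk′ x c
      x⇝c = G′.mapʷ _ (G′.walk-along (relink vert opp opp-invol opp′ opp′-invol unchanged-in-cB cB-linked)
                                      x∈B (here refl))
      a⇝h : Walk′ a h
      a⇝h = G′.step xa _ (G′.castʷ (sym (cong vert opp′-xa)) refl y⇝h)
      b⇝c : Walk′ b c
      b⇝c = G′.step xb _ (G′.castʷ (sym (cong vert opp′-xb)) refl x⇝c)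
      h⇝c : Walk′ h c
      h⇝c = G′.castʷ ya-h refl (G′.step (opp xa) _ (G′.castʷ (sym (trans (cong vert opp′-ya) yb-c)) refl G′.stop))
      y⇝x : Walk′ y x
      y⇝x = y⇝h G′.++ʷ (h⇝c G′.++ʷ rev′ x⇝c)

      old-edge : ∀ d → Walk′ (vert d) (target d)
      old-edge d with kind d
      ... | is-xa refl = G′.castʷ refl (sym ya-h) a⇝h
      ... | is-xb refl = G′.castʷ refl (sym yb-c) b⇝c
      ... | is-z  refl = y⇝x
      ... | is-z* refl = G′.castʷ refl (sym (target-opp z)) (rev′ y⇝x)
      ... | is-ya refl = G′.castʷ (sym ya-h) (sym (cong vert (opp-invol xa))) (rev′ a⇝h)
      ... | is-yb refl = G′.castʷ (sym yb-c) (sym (cong vert (opp-invol xb))) (rev′ b⇝c)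
      ... | unaffected n₁ n₂ n₃ n₄ n₅ n₆ =
        G′.step d _ (G′.castʷ (sym (cong vert (opp′-unaffected n₁ n₂ n₃ n₄ n₅ n₆))) refl G′.stop)

      simulate : ∀ {u v} → WalkVia (const ⊤) u v → Walk′ u v
      simulate stop         = G′.stop
      simulate (step d _ p) = old-edge d G′.++ʷ simulate p

    moved : Rewiring
    moved = record
      { opp = opp′ ; opp-invol = opp′-invol ; opp-nofix = opp′-nofix
      ; connected = λ u v → G′.toWalk (simulate (fromWalk (connected u v))) }

    glue-cut : GlueCut (rewire r) (rewire moved)
    glue-cut = xa , xb , z , xa≢xb , L-gh , L-gc , (λ q → xa≢xb* (trans (sym (opp-invol xa)) (cong opp q)))
             , xa≢z ∘ sym , xb≢z ∘ sym , (λ _ → refl) , (λ _ → refl) , (λ _ → refl) , (λ _ → refl)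

    gh-to-c : Graph.target moved gh ≡ c
    gh-to-c = trans (cong (vert ∘ opp′) (sym (opp-invol gh))) (trans (cong vert opp′-ya) yb-c)

    unchanged-away : ∀ {d} → vert d ∈ ps → vert d ≢ h → vert d ≢ y → opp′ d ≡ opp d
    unchanged-away {d} d∈ d≢h d≢y with kind d
    ... | is-xa refl = ⊥-elim (leaf∉ ps-internal leaf-a d∈)
    ... | is-xb refl = ⊥-elim (leaf∉ ps-internal leaf-b d∈)
    ... | is-z  refl = ⊥-elim (d≢y refl)
    ... | is-z* refl = ⊥-elim (z∉P d∈)
    ... | is-ya refl = ⊥-elim (d≢h ya-h)
    ... | is-yb refl = ⊥-elim (c∉P (subst (_∈ ps) yb-c d∈))
    ... | unaffected n₁ n₂ n₃ n₄ n₅ n₆ = opp′-unaffected n₁ n₂ n₃ n₄ n₅ n₆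

    leaf-dart : ∀ {d} → deg (vert d) ≡ 1 → d ≡ xa ⊎ d ≡ xb ⊎ opp′ d ≡ opp d
    leaf-dart {d} leaf with kind d
    ... | is-xa q    = inj₁ q
    ... | is-xb q    = inj₂ (inj₁ q)
    ... | is-z  refl = ⊥-elim (Internal⇒¬leaf int-y leaf)
    ... | is-z* refl = ⊥-elim (Internal⇒¬leaf int-x leaf)
    ... | is-ya refl = ⊥-elim (Internal⇒¬leaf int-h (subst (λ v → deg v ≡ 1) ya-h leaf))
    ... | is-yb refl = ⊥-elim (Internal⇒¬leaf int-c (subst (λ v → deg v ≡ 1) yb-c leaf))
    ... | unaffected n₁ n₂ n₃ n₄ n₅ n₆ = inj₂ (inj₂ (opp′-unaffected n₁ n₂ n₃ n₄ n₅ n₆))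

    nice-moved : NiceLeaf → Graph.NiceLeaf moved
    nice-moved nice v L̄v leaf with nice v L̄v leaf
    ... | w , (d , d-v , d-w) , max with leaf-dart {d} (subst (λ u → deg u ≡ 1) (sym d-v) leaf)
    ... | inj₁ refl        = ⊥-elim (true≢false (trans (sym L-gh) (trans (cong L d-v) L̄v)))
    ... | inj₂ (inj₁ refl) = ⊥-elim (true≢false (trans (sym L-gc) (trans (cong L d-v) L̄v)))
    ... | inj₂ (inj₂ same) = w , (d , d-v , trans (cong vert same) d-w) , max

    still-reached : ∀ {v d} → deg v ≡ 1 → vert d ≡ v → target d ∈ ps →
      ∃[ d′ ] (vert d′ ≡ v × Graph.target moved d′ ∈ ps)
    still-reached {v} {d} leaf d-v d∈ with leaf-dart {d} (subst (λ u → deg u ≡ 1) (sym d-v) leaf)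
    ... | inj₁ refl        = xa , d-v , subst (_∈ ps) (sym (cong vert opp′-xa)) z∈P
    ... | inj₂ (inj₁ refl) = ⊥-elim (c∉P (subst (_∈ ps) yb-c d∈))
    ... | inj₂ (inj₂ same) = d , d-v , subst (_∈ ps) (sym (cong vert same)) d∈

    tip-moved : ∀ {t} → t ∈ ps → t ≢ h → t ≢ y → Tip t → Graph.Tip moved t
    tip-moved {t} t∈ t≢h t≢y tip e-t e′-t int int′ =
      tip e-t e′-t (subst Internal (cong vert (same e-t)) int) (subst Internal (cong vert (same e′-t)) int′)
      where
      same : ∀ {e} → vert e ≡ t → opp′ e ≡ opp e
      same e-t = unchanged-away (subst (_∈ ps) (sym e-t) t∈) (t≢h ∘ trans (sym e-t)) (t≢y ∘ trans (sym e-t))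

    unreached-not-increased : unreached moved ps ≤ unreached r ps
    unreached-not-increased = unreached-mono {r} {moved} λ (leaf , ¬reached) →
      leaf , λ (d , d-v , d∈) → ¬reached (still-reached leaf d-v d∈)

    private
      module M = Graph moved
      regrown : M.Extension (M.mkPath h (InternalPath.rest P) (InternalPath.unique P) ps-linked′ ps-internal
                                      (InternalPath.avoids P))
      regrown = M.extend _
    open M.Extension regrown using (maximal; same-end; extends) renaming (extended to Q)
    open M.InternalPath Q using () renaming (first to h₂; vertices to ps₂; internal to ps₂-internal)

    private
      regrown-stuck : ∀ {e} → vert e ≡ h₂ → Internal (M.target e) → M.target e ∈ ps₂
      regrown-stuck e-h₂ int = [ (λ ()) , id ] (maximal e-h₂ int)

    respine : Tip (InternalPath.end P) → InternalPath.end P ≢ h → InternalPath.end P ≢ y → Spine moved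
    respine tip end≢h end≢y = record
      { path = Q ; head-stuck = regrown-stuck
      ; end-tip = subst M.Tip (sym same-end) (tip-moved (lastOf-∈ h _) end≢h end≢y tip) }

    -- The glued edge makes c ∉ ps a neighbour of h, so the regrown spine has a new head h₂,
    -- and a leaf at h₂ was not adjacent to the old spine.
    regrown-shrinks : unreached moved ps₂ < unreached moved ps
    regrown-shrinks = shrinks (M.internal-tip-leaf (All-lookup ps₂-internal (here refl))
                                                   (M.stuck-head-tip M.acyclic Q regrown-stuck))
      where
      h₂∉ps : h₂ ∉ ps
      h₂∉ps = M.extension-grows regrown
                (gh-h , subst Internal (sym gh-to-c) int-c , (λ ()) , λ c∈ → c∉P (subst (_∈ ps) gh-to-c c∈))
      grown : ∀ {v} → Unreached moved ps₂ v → Unreached moved ps v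
      grown (leaf , ¬reached) = leaf , λ (d , d-v , d∈) → ¬reached (d , d-v , extends d∈)
      shrinks : ∃[ g ] (vert g ≡ h₂ × ¬ Internal (M.target g)) → unreached moved ps₂ < unreached moved ps
      shrinks (g , g-h₂ , ¬int) = unreached-mono-< {moved} {moved} {ps} {ps₂} grown (M.target g) reached-now unreached-before
        where
        back-to-h₂ : M.target (opp′ g) ≡ h₂
        back-to-h₂ = trans (cong vert (opp′-invol g)) g-h₂
        leaf : deg (M.target g) ≡ 1
        leaf = ¬Internal⇒leaf {opp′ g} refl ¬int
        reached-now : ¬ Unreached moved ps₂ (M.target g)
        reached-now (_ , ¬reached) = ¬reached (opp′ g , refl , subst (_∈ ps₂) (sym back-to-h₂) (here refl))
        unreached-before : Unreached moved ps (M.target g)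
        unreached-before = leaf , λ (d , d-at , d∈) →
          h₂∉ps (subst (_∈ ps) (trans (cong M.target (leaf-dart-unique leaf d-at refl)) back-to-h₂) d∈)

  module _ {r : Rewiring} (S : Spine r) where
    open Graph r
    open Spine S
    open InternalPath path

    branch-point : ∀ {z} → vert z ∈ vertices → target z ∉ vertices → Internal (target z) →
      vert z ≢ first × vert z ≢ end × 3 ≤ deg (vert z)
    branch-point {z} z∈ z∉ int = z≢first , z≢end , interior-deg≥3 linked unique z∈ z∉ z≢first z≢end
      where
      z≢first : vert z ≢ first
      z≢first z-h = z∉ (head-stuck z-h int)
      z≢end : vert z ≢ end
      z≢end z-end = z∉ (tip-end-stuck linked internal end-tip head-stuck z-end int)

    end≢first : ∀ {v} → v ∈ vertices → v ≢ first → end ≢ first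
    end≢first (here v≡first) v≢first = ⊥-elim (v≢first v≡first)
    end≢first (there v∈rest) _      = lastOf≢head unique v∈rest

    module _ {z} (z∈ : vert z ∈ vertices) (z∉ : target z ∉ vertices) (int : Internal (target z)) where
      private
        X : Extension (mkPath (target z) [] ([] ∷ []) [-] (int ∷ []) (z∉ ∷ []))
        X = extend _
      open Extension X using (maximal; same-end; extends) renaming (extended to B)
      open InternalPath B using () renaming (first to c; vertices to cB; rest to cB-rest)

      branch : InternalPath vertices
      branch = B

      target∈branch : target z ∈ cB
      target∈branch = extends (here refl)

      -- Internal neighbours of c on the branch are unique by acyclicity; one on the spine is
      -- reached through opp z only, and then c = x would be both ends of the branch.
      branch-head-tip : Tip c
      branch-head-tip {e} {e′} e-c e′-c int-e int-e′ = tip-cases (maximal e-c int-e) (maximal e′-c int-e′)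
        where
        to-z* : ∀ {e} → vert e ≡ c → target e ∈ vertices → e ≡ opp z
        to-z* e-c e∈ = crossing-dart-unique acyclic linked (InternalPath.linked B) (InternalPath.avoids B)
                         z∈ target∈branch (subst (_∈ cB) (sym e-c) (here refl)) e∈
        mixed : ∀ {e e′} → vert e ≡ c → e ≡ opp z → vert e′ ≡ c → target e′ ∈ cB → ⊥
        mixed e-c refl e′-c (here q)         = no-loop acyclic _ (trans e′-c (sym q))
        mixed e-c refl e′-c (there e′∈rest) = lastOf≢head (InternalPath.unique B) e′∈rest (trans same-end e-c)
        tip-cases : target e ∈ vertices ⊎ target e ∈ cB → target e′ ∈ vertices ⊎ target e′ ∈ cB → e ≡ e′
        tip-cases (inj₁ m) (inj₁ m′) = trans (to-z* e-c m) (sym (to-z* e′-c m′))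
        tip-cases (inj₂ m) (inj₂ m′) = end-dart-unique acyclic (InternalPath.linked B) (InternalPath.unique B) e-c e′-c m m′
        tip-cases (inj₁ m) (inj₂ m′) = ⊥-elim (mixed e-c (to-z* e-c m) e′-c m′)
        tip-cases (inj₂ m) (inj₁ m′) = ⊥-elim (mixed e′-c (to-z* e′-c m′) e-c m)

  Offshoot : Rewiring → List (Fin nV) → Fin nD → Set
  Offshoot r ps z = vert z ∈ ps × Internal (Graph.target r z) × Graph.target r z ∉ ps

  Offshoot? : ∀ r ps z → Dec (Offshoot r ps z)
  Offshoot? r ps z = vert z ∈? ps ×-dec Internal? (Graph.target r z) ×-dec ¬? (Graph.target r z ∈? ps)

  spine-vertices : ∀ {r} → Spine r → List (Fin nV)
  spine-vertices {r} S = Graph.InternalPath.vertices r (Spine.path S)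

  spine-from : ∀ {r v} → Internal v → Spine r
  spine-from {r} int =
    let open Graph r
        Q₀ , _ , stuck₀ = maximal-path int
        Q , end≡first₀ , stuck = maximal-path (All-lookup (InternalPath.internal Q₀) (here refl))
    in record { path = Q ; head-stuck = stuck ; end-tip = subst Tip (sym end≡first₀) (stuck-head-tip acyclic Q₀ stuck₀) }

  caterpillar : ∀ {r} (S : Spine r) → (∀ z → ¬ Offshoot r (spine-vertices S) z) → DTree.Caterpillar (rewire r)
  caterpillar {r} S none =
    vertices , unique , (λ v → mk⇔ (closed⇒internal∈ connected (here refl) closed) (All-lookup internal)) , linked
    where
    open Graph r
    open InternalPath (Spine.path S)
    closed : Closed vertices
    closed {d} d∈ int with target d ∈? vertices
    ... | yes d∈′ = d∈′
    ... | no  d∉  = ⊥-elim (none d (d∈ , int , d∉))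

  Straightened : ℕ → Rewiring → Set
  Straightened n r = ∃[ m ] ∃[ r′ ]
    (GCPath m (rewire r) (rewire r′) × m ≤ n × Graph.NiceLeaf r′ × DTree.Caterpillar (rewire r′))

  Advanced : ∀ r → Spine r → Set
  Advanced r S = ∃[ r′ ] (GlueCut (rewire r) (rewire r′) × Graph.NiceLeaf r′ ×
                         Σ (Spine r′) λ S′ → unreached r′ (spine-vertices S′) < unreached r (spine-vertices S))

  module _ (μ₁≤1 : μ 1 ≤ 1) where

    advance : ∀ {r} → Graph.NiceLeaf r → (S : Spine r) → ∀ {z} → Offshoot r (spine-vertices S) z → Advanced r S
    advance {r} nice S {z} (z∈ , int , z∉) =
      let open Graph r
          open Spine S
          open InternalPath path
          z≢first , z≢end , deg≥3 = branch-point S z∈ z∉ int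
          B = branch S z∈ z∉ int
          gh , gh-h , L-gh = tip-L-leaf μ₁≤1 r nice deg≥3 (All-lookup internal (here refl))
                                        (stuck-head-tip acyclic path head-stuck)
          gc , gc-c , L-gc = tip-L-leaf μ₁≤1 r nice deg≥3 (All-lookup (InternalPath.internal B) (here refl))
                                        (branch-head-tip S z∈ z∉ int)
          open Move r path z z∈ z∉ B (target∈branch S z∈ z∉ int) gh gh-h L-gh gc gc-c L-gc
      in moved , glue-cut , nice-moved nice , respine end-tip (end≢first S z∈ z≢first) (z≢end ∘ sym)
         , <-≤-trans regrown-shrinks unreached-not-increased

    straighten : ∀ n {r} → Graph.NiceLeaf r → (S : Spine r) → unreached r (spine-vertices S) ≤ n → Straightened n r
    straighten-after : ∀ n {r} {S : Spine r} → unreached r (spine-vertices S) ≤ n → Advanced r S → Straightened n r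

    straighten n {r} nice S bound with any? (Offshoot? r (spine-vertices S))
    ... | no none     = 0 , r , done , z≤n , nice , caterpillar S (λ z o → none (z , o))
    ... | yes (_ , o) = straighten-after n {r} {S} bound (advance nice S o)

    straighten-after zero    bound (_ , _ , _ , _ , shrinks) = ⊥-elim (n≮0 (<-≤-trans shrinks bound))
    straighten-after (suc n) bound (r′ , glue-cut , nice′ , S′ , shrinks) =
      let m , r″ , steps , m≤n , nice″ , cat = straighten n nice′ S′ (≤-pred (<-≤-trans shrinks bound))
      in suc m , r″ , step glue-cut steps , s≤s m≤n , nice″ , cat

m≡k-n⇒k≡m+n : ∀ {m k n : ℤ.ℤ} → m ≡ k ℤ.- n → k ≡ m ℤ.+ n
m≡k-n⇒k≡m+n {k = k} {n} refl =
  sym (trans (ℤP.+-assoc k (ℤ.- n) n) (trans (cong (λ j → k ℤ.+ j) (ℤP.+-inverseˡ n)) (ℤP.+-identityʳ k)))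

within-k : ∀ {nV nD} (T : DTree nV nD) → + DTree.ℓ T ≡ DTree.k T ℤ.- + 2 →
  ∀ {n} → n ≤ DTree.ℓ T + 1 → + n ℤ.≤ DTree.k T
within-k T ℓ≡k-2 n≤ =
  subst (_ ℤ.≤_) (sym (m≡k-n⇒k≡m+n {+ DTree.ℓ T} {DTree.k T} {+ 2} ℓ≡k-2))
        (ℤ.+≤+ (≤-trans n≤ (+-monoʳ-≤ (DTree.ℓ T) (m≤m+n 1 1))))

lemma4p7 : ∀ {nV nD} (T : DTree nV nD) →
    DTree.μ T 1 ≤ 1 →
    DTree.Nice T →
    + DTree.ℓ T ≡ DTree.k T ℤ.- + 2 →
    ∃[ n ] ∃[ T' ] (GCPath n T T' × (+ n) ℤ.≤ DTree.k T
    × (∀ i → DTree.μ T' i ≡ DTree.μ T i) × DTree.ℓ T' ≡ DTree.ℓ T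
    × DTree.Nice T' × DTree.Caterpillar T')
lemma4p7 T μ₁≤1 nice ℓ≡k-2 with any? (Degrees.Internal? (DTree.vert T))
... | no none = 0 , T , done , within-k T ℓ≡k-2 z≤n , (λ _ → refl) , refl , nice ,
                [] , [] , (λ v → mk⇔ (λ int → ⊥-elim (none (v , int))) λ ()) , []
... | yes (_ , int) =
  let S = spine-from T int
      n , r , steps , n≤ , nice′ , cat = straighten T μ₁≤1 (DTree.ℓ T + 1) (nice-initial T nice) S
        (≤-trans (unreached≤ℓ+μ₁ T (initial T) (spine-vertices T S)) (+-monoʳ-≤ (DTree.ℓ T) μ₁≤1))
  in n , rewire T r , steps , within-k T ℓ≡k-2 n≤ , (λ _ → refl) , refl , nice-rewired T nice r nice′ , cat
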